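{- (Taxicab Lemma) For vertices $u=(x,y)$ and $v=(x',y')$ of the hexagonal grid $G_H$, if $|x-x'|\ge|y-y'|$, then $d(u,v)=\|u-v\|_1=|x-x'|+|y-y'|$.
   Context: The hexagonal grid $G_H$ (brick-wall representation) has vertex set $\mathbb{Z}\times\mathbb{Z}$; every vertex $(x,y)$ is adjacent to $(x-1,y)$ and $(x+1,y)$, and additionally to $(x,y+1)$ if $x+y$ is even, and to $(x,y-1)$ if $x+y$ is odd. $d(u,v)$ denotes the graph distance in $G_H$. -}

module Defs where

open import Data.Integer using (ℤ; _+_; _-_; ∣_∣; +_)
open import Data.Integer.Base using (1ℤ; -1ℤ)
open import Data.Nat using (ℕ; zero; suc; _≤_)
open import Data.Nat.Divisibility using (_∣_)
open import Relation.Nullary using (¬_)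
open import Data.Product using (_×_; _,_; ∃-syntax)
open import Relation.Binary.PropositionalEquality using (_≡_)

-- vertices of the hexagonal grid G_H (brick-wall representation)
Vertex : Set
Vertex = ℤ × ℤ

EvenZ : ℤ → Set
EvenZ z = 2 ∣ ∣ z ∣

OddZ : ℤ → Set
OddZ z = ¬ (2 ∣ ∣ z ∣)

data Adj : Vertex → Vertex → Set where
  left  : ∀ x y → Adj (x , y) (x - 1ℤ , y)
  right : ∀ x y → Adj (x , y) (x + 1ℤ , y)
  up    : ∀ x y → EvenZ (x + y) → Adj (x , y) (x , y + 1ℤ)
  down  : ∀ x y → OddZ (x + y) → Adj (x , y) (x , y - 1ℤ)

data Walk : Vertex → Vertex → ℕ → Set where
  [] : ∀ {u} → Walk u u zero
  _∷_ : ∀ {u v w n} → Adj u v → Walk v w n → Walk u w (suc n)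

Dist : Vertex → Vertex → ℕ → Set
Dist u v n = Walk u v n × (∀ m → Walk u v m → n ≤ m)

l1 : Vertex → Vertex → ℕ
l1 (x , y) (x' , y') = ∣ x - x' ∣ Data.Nat.+ ∣ y - y' ∣

module Submission where

-- Lower bound: every edge changes one coordinate by exactly 1, so it changes the
-- ℓ1-distance to any fixed target by at most 1; hence no walk is shorter than the
-- ℓ1-distance of its endpoints.
--
-- Upper bound: a horizontal step flips the parity of x + y, and the vertical edge in
-- direction ±1 exists exactly at vertices of one fixed parity.  So from any vertex one
-- of the two orders "vertical then horizontal" / "horizontal then vertical" is
-- available, giving a walk of length 2 along any diagonal (x,y) ↦ (x ± 1, y ± 1).
-- With |dy| ≤ |dx| we take |dy| diagonal moves followed by |dx| - |dy| horizontal
-- moves: a walk of length |dx| + |dy|.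

open import Defs
open import Data.Integer using (ℤ; _-_; ∣_∣)
open import Data.Nat using (_≤_)
open import Data.Product using (_,_)

open import Data.Integer using (+_; -[1+_]; _+_; -_; sign; _◃_)
open import Data.Integer.Base using (1ℤ; -1ℤ)
import Data.Integer.Properties as ℤP
import Data.Integer.Divisibility.Signed as ℤDiv
open import Data.Integer.Tactic.RingSolver using (solve-∀)

open import Data.Nat as ℕ using (zero; suc; z≤n; s≤s)
import Data.Nat.Properties as ℕP
open import Data.Nat.Divisibility using (_∣_; _∣?_; divides; ∣1⇒≡1)
open import Data.Sign using (Sign)
open import Data.Sum using (_⊎_; inj₁; inj₂)
open import Relation.Nullary using (yes; no; contradiction)
open import Relation.Binary.PropositionalEquality

ℕ-parity : ∀ n → (2 ∣ n) ⊎ (2 ∣ suc n)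
ℕ-parity zero = inj₁ (divides 0 refl)
ℕ-parity (suc n) with ℕ-parity n
... | inj₁ (divides q n≡2q) = inj₂ (divides (suc q) (cong (λ k → suc (suc k)) n≡2q))
... | inj₂ 2∣1+n = inj₁ 2∣1+n

∣-[1+n]+1∣ : ∀ n → ∣ -[1+ n ] + 1ℤ ∣ ≡ n
∣-[1+n]+1∣ zero = refl
∣-[1+n]+1∣ (suc n) = refl

ℤ-parity : ∀ z → EvenZ z ⊎ EvenZ (z + 1ℤ)
ℤ-parity (+ n) with ℕ-parity n
... | inj₁ 2∣n = inj₁ 2∣n
... | inj₂ 2∣1+n = inj₂ (subst (2 ∣_) (ℕP.+-comm 1 n) 2∣1+n)
ℤ-parity -[1+ n ] with ℕ-parity n
... | inj₁ 2∣n = inj₂ (subst (2 ∣_) (sym (∣-[1+n]+1∣ n)) 2∣n)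
... | inj₂ 2∣1+n = inj₁ 2∣1+n

unit : Sign → ℤ
unit s = s ◃ 1

-- An even integer moved by a unit step becomes odd (otherwise 2 would divide ±1).
even-step : ∀ s z → EvenZ z → OddZ (z + unit s)
even-step s z 2∣z 2∣z+u =
  contradiction (∣1⇒≡1 (subst (2 ∣_) (ℤP.abs-◃ s 1) (ℤDiv.∣⇒∣ᵤ 2∣u))) λ ()
  where
    2∣u : (+ 2) ℤDiv.∣ unit s
    2∣u = ℤDiv.∣m+n∣m⇒∣n {m = z} (ℤDiv.∣ᵤ⇒∣ 2∣z+u) (ℤDiv.∣ᵤ⇒∣ 2∣z)

odd-step : ∀ s z → OddZ z → EvenZ (z + unit s)
odd-step Sign.+ z odd with ℤ-parity z
... | inj₁ even = contradiction even odd
... | inj₂ even = even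
odd-step Sign.- z odd with ℤ-parity (z + -1ℤ)
... | inj₁ even = even
... | inj₂ even = contradiction (subst EvenZ (back z) even) odd
  where
    back : ∀ z → (z + -1ℤ) + 1ℤ ≡ z
    back = solve-∀

coordinate-step : ∀ a e c → ∣ a - c ∣ ≤ ∣ e ∣ ℕ.+ ∣ (a + e) - c ∣
coordinate-step a e c = begin
  ∣ a - c ∣                      ≡⟨ cong ∣_∣ (split a e c) ⟩
  ∣ - e + ((a + e) - c) ∣        ≤⟨ ℤP.∣i+j∣≤∣i∣+∣j∣ (- e) ((a + e) - c) ⟩
  ∣ - e ∣ ℕ.+ ∣ (a + e) - c ∣    ≡⟨ cong (ℕ._+ ∣ (a + e) - c ∣) (ℤP.∣-i∣≡∣i∣ e) ⟩
  ∣ e ∣ ℕ.+ ∣ (a + e) - c ∣      ∎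
  where
    open ℕP.≤-Reasoning
    split : ∀ a e c → a - c ≡ - e + ((a + e) - c)
    split = solve-∀

l1-edge : ∀ {u v} w → Adj u v → l1 u w ≤ suc (l1 v w)
l1-edge (a , c) (left x y) = ℕP.+-monoˡ-≤ ∣ y - c ∣ (coordinate-step x -1ℤ a)
l1-edge (a , c) (right x y) = ℕP.+-monoˡ-≤ ∣ y - c ∣ (coordinate-step x 1ℤ a)
l1-edge (a , c) (up x y _) = ℕP.≤-trans
  (ℕP.+-monoʳ-≤ ∣ x - a ∣ (coordinate-step y 1ℤ c)) (ℕP.≤-reflexive (ℕP.+-suc ∣ x - a ∣ _))
l1-edge (a , c) (down x y _) = ℕP.≤-trans
  (ℕP.+-monoʳ-≤ ∣ x - a ∣ (coordinate-step y -1ℤ c)) (ℕP.≤-reflexive (ℕP.+-suc ∣ x - a ∣ _))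

l1-self : ∀ u → l1 u u ≡ 0
l1-self (x , y) = cong₂ ℕ._+_ (∣x-x∣ x) (∣x-x∣ y)
  where
    ∣x-x∣ : ∀ x → ∣ x - x ∣ ≡ 0
    ∣x-x∣ x = cong ∣_∣ (ℤP.+-inverseʳ x)

l1≤length : ∀ {u w m} → Walk u w m → l1 u w ≤ m
l1≤length {u} [] = ℕP.≤-reflexive (l1-self u)
l1≤length {w = w} (e ∷ p) = ℕP.≤-trans (l1-edge w e) (s≤s (l1≤length p))

_++_ : ∀ {u v w m n} → Walk u v m → Walk v w n → Walk u w (m ℕ.+ n)
[] ++ q = q
(e ∷ p) ++ q = e ∷ (p ++ q)

cast : ∀ {u v v' m m'} → v ≡ v' → m ≡ m' → Walk u v m → Walk u v' m'
cast refl refl p = p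

horizontal : ∀ s x y → Adj (x , y) (x + unit s , y)
horizontal Sign.+ = right
horizontal Sign.- = left

VerticalOK : Sign → ℤ → Set
VerticalOK Sign.+ = EvenZ
VerticalOK Sign.- = OddZ

vertical : ∀ t x y → VerticalOK t (x + y) → Adj (x , y) (x , y + unit t)
vertical Sign.+ = up
vertical Sign.- = down

-- Since a unit step flips parity, the vertical edge is available here or one step away.
vertical-nearby : ∀ s t z → VerticalOK t z ⊎ VerticalOK t (z + unit s)
vertical-nearby s t z with t | 2 ∣? ∣ z ∣
... | Sign.+ | yes even = inj₁ even
... | Sign.+ | no odd = inj₂ (odd-step s z odd)
... | Sign.- | yes even = inj₂ (even-step s z even)
... | Sign.- | no odd = inj₁ odd

diagonal : ∀ s t x y → Walk (x , y) (x + unit s , y + unit t) 2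
diagonal s t x y with vertical-nearby s t (x + y)
... | inj₁ ok = vertical t x y ok ∷ (horizontal s x (y + unit t) ∷ [])
... | inj₂ ok =
  horizontal s x y ∷ (vertical t (x + unit s) y (subst (VerticalOK t) (swap x y (unit s)) ok) ∷ [])
  where
    swap : ∀ x y u → (x + y) + u ≡ (x + u) + y
    swap = solve-∀

advance : ∀ s n x → (x + unit s) + (s ◃ n) ≡ x + (s ◃ suc n)
advance s n x = trans (ℤP.+-assoc x (unit s) (s ◃ n)) (cong (λ k → x + k) (unit+◃ s n))
  where
    unit+◃ : ∀ s n → unit s + (s ◃ n) ≡ s ◃ suc n
    unit+◃ Sign.+ zero = refl
    unit+◃ Sign.+ (suc n) = refl
    unit+◃ Sign.- zero = refl
    unit+◃ Sign.- (suc n) = refl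

straight : ∀ s n x y → Walk (x , y) (x + (s ◃ n) , y) n
straight s zero x y = cast (cong (_, y) (sym (ℤP.+-identityʳ x))) refl []
straight s (suc n) x y =
  horizontal s x y ∷ cast (cong (_, y) (advance s n x)) refl (straight s n (x + unit s) y)

staircase : ∀ s t {n b} → b ≤ n → ∀ x y → Walk (x , y) (x + (s ◃ n) , y + (t ◃ b)) (n ℕ.+ b)
staircase s t {n} z≤n x y =
  cast (cong (x + (s ◃ n) ,_) (sym (ℤP.+-identityʳ y))) (sym (ℕP.+-identityʳ n)) (straight s n x y)
staircase s t {suc n} {suc b} (s≤s b≤n) x y =
  cast (cong₂ _,_ (advance s n x) (advance t b y)) (cong suc (sym (ℕP.+-suc n b)))
    (diagonal s t x y ++ staircase s t b≤n (x + unit s) (y + unit t))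

displacement-walk : ∀ x y dx dy → ∣ dy ∣ ≤ ∣ dx ∣ →
  Walk (x , y) (x + dx , y + dy) (∣ dx ∣ ℕ.+ ∣ dy ∣)
displacement-walk x y dx dy dy≤dx =
  cast (cong₂ _,_ (cong (λ k → x + k) (ℤP.◃-inverse dx)) (cong (λ k → y + k) (ℤP.◃-inverse dy))) refl
    (staircase (sign dx) (sign dy) dy≤dx x y)

claim2 : ∀ (x y x' y' : ℤ) → ∣ y - y' ∣ ≤ ∣ x - x' ∣ →
    Dist (x , y) (x' , y') (l1 (x , y) (x' , y'))
claim2 x y x' y' dy≤dx = shortest , λ m p → l1≤length p
  where
    ∣dx∣ : ∣ x - x' ∣ ≡ ∣ x' - x ∣
    ∣dx∣ = ℤP.∣i-j∣≡∣j-i∣ x x'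
    ∣dy∣ : ∣ y - y' ∣ ≡ ∣ y' - y ∣
    ∣dy∣ = ℤP.∣i-j∣≡∣j-i∣ y y'

    arrive : ∀ a a' → a + (a' - a) ≡ a'
    arrive = solve-∀

    shortest : Walk (x , y) (x' , y') (l1 (x , y) (x' , y'))
    shortest = cast (cong₂ _,_ (arrive x x') (arrive y y')) (sym (cong₂ ℕ._+_ ∣dx∣ ∣dy∣))
      (displacement-walk x y (x' - x) (y' - y) (subst₂ _≤_ ∣dy∣ ∣dx∣ dy≤dx))
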